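{- Let $n$ be an odd squarefree integer and $A=S(n)$. Let $S=(x_1,\ldots,x_l)$ be a sequence in $\mathbb{Z}_n$ such that for every prime divisor $p$ of $n$, at least two terms of $S$ are coprime to $p$. Suppose at most one term of $S$ is a unit. Then $S$ is an $A$-weighted zero-sum sequence.
   Context: $\mathbb{Z}_n=\mathbb{Z}/n\mathbb{Z}$, $U(n)$ its unit group. For $A\subseteq\mathbb{Z}_n$, a sequence $(x_1,\ldots,x_l)$ is an $A$-weighted zero-sum sequence if $a_1x_1+\cdots+a_lx_l=0$ for some $a_1,\ldots,a_l\in A$. For odd $n=\prod p_i^{r_i}$ and $a\in U(n)$, $\left(\frac{a}{n}\right)=\prod_i\left(\frac{a\bmod p_i}{p_i}\right)^{r_i}$ (Legendre symbols), and $S(n)$ is the kernel of $a\mapsto\left(\frac{a}{n}\right)$ on $U(n)$. -}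

module Defs where

open import Data.Nat using (ℕ; zero; suc; _+_; _*_; _^_; ∣_-_∣)
open import Data.Nat.Divisibility using (_∣_; _∣?_)
open import Data.Nat.Primality using (Prime; prime?)
open import Data.Nat.Coprimality using (Coprime)
open import Data.Integer as ℤ using (ℤ; +_; -_)
open import Data.Fin using (Fin; toℕ)
import Data.Fin
import Data.Bool
open import Data.List using (List; []; _∷_; filter; upTo; applyUpTo; length; foldr)
open import Data.Bool.ListAction using (any)
open import Data.Bool using (if_then_else_)
open import Data.Product using (Σ; _×_; ∃)
open import Relation.Nullary using (¬_; does)
open import Relation.Nullary.Decidable using (_×-dec_)
open import Relation.Binary.PropositionalEquality using (_≡_; _≢_)

sumFin : (l : ℕ) → (Fin l → ℕ) → ℕ
sumFin zero    f = 0
sumFin (suc l) f = f Data.Fin.zero + sumFin l (λ i → f (Data.Fin.suc i))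

Squarefree : ℕ → Set
Squarefree n = ∀ p → Prime p → ¬ (p * p ∣ n)

Odd : ℕ → Set
Odd n = ¬ (2 ∣ n)

primeDivisors : ℕ → List ℕ
primeDivisors n = filter (λ p → prime? p ×-dec (p ∣? n)) (upTo (suc n))

-- multiplicity r of p in n (n ≥ 1, p ≥ 2): number of k ∈ {1,…,n} with p^k ∣ n
multiplicity : ℕ → ℕ → ℕ
multiplicity p n = length (filter (λ k → (p ^ k) ∣? n) (applyUpTo suc n))

isQR : ℕ → ℕ → Data.Bool.Bool
isQR p a = any (λ y → does (p ∣? ∣ y * y - a ∣)) (upTo p)

-- Legendre symbol (a/p) for p an odd prime and a coprime to p
legendre : ℕ → ℕ → ℤ
legendre p a = if isQR p a then + 1 else - (+ 1)

jacobi : ℕ → ℕ → ℤ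
jacobi n a = foldr (λ p acc → (legendre p a ℤ.^ multiplicity p n) ℤ.* acc) (+ 1) (primeDivisors n)

IsUnit : (n : ℕ) → Fin n → Set
IsUnit n x = Coprime (toℕ x) n

InS : (n : ℕ) → Fin n → Set
InS n a = IsUnit n a × jacobi n (toℕ a) ≡ + 1

WeightedZeroSum : (n : ℕ) → (A : Fin n → Set) → (l : ℕ) → (Fin l → Fin n) → Set
WeightedZeroSum n A l x =
  Σ (Fin l → Fin n) λ a → (∀ i → A (a i)) × (n ∣ sumFin l (λ i → toℕ (a i) * toℕ (x i)))

-- For each prime p ∣ n, two terms coprime to p allow weights, all units mod p, that
-- make the sequence a zero sum mod p: weight 1 everywhere except at those two terms,
-- where one weight is solved for and the other is 1 or 2 (a unit, p being odd) so that
-- the solved weight is a unit too. If some term is a unit mod n (there is at most one),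
-- the weights are scaled so that its weight is 1 at every p. As n is squarefree, the
-- Chinese remainder theorem glues these residues into weights in ℤ_n; the unit term
-- gets weight 1 ∈ S(n). Every other term is divisible by some prime q ∣ n, so the
-- residue of its weight at q does not matter for the sum, and choosing it to be 1 or a
-- quadratic non-residue mod q makes the Jacobi symbol of the weight, the product of the
-- Legendre symbols at the primes of n, equal to 1.

module Submission where

open import Defs
open import Data.Nat using (ℕ)
open import Data.Nat.Divisibility using (_∣_)
open import Data.Nat.Primality using (Prime)
open import Data.Nat.Coprimality using (Coprime)
open import Data.Fin using (Fin; toℕ)
open import Data.Product using (Σ; _×_)
open import Relation.Binary.PropositionalEquality using (_≡_; _≢_)

open import Data.Bool using (true; false; T; if_then_else_)
open import Data.Empty using (⊥-elim)
open import Data.Fin as Fin using (fromℕ<; _≟_)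
import Data.Fin.Properties as Finₚ
open import Data.Integer as ℤ using (ℤ; +_; -_; _+_; _*_; _-_; _⊖_; 0ℤ; 1ℤ; -1ℤ)
import Data.Integer.Properties as ℤₚ
open import Data.Integer.DivMod using (_%ℕ_; _/ℕ_; n%ℕd<d; a≡a%ℕn+[a/ℕn]*n)
open import Data.Integer.Divisibility.Signed as ℤ∣ using () renaming (_∣_ to _∣ᶻ_; _∣?_ to _∣ᶻ?_)
open import Data.Integer.Tactic.RingSolver using (solve-∀)
open import Algebra.Properties.Semiring.Sum ℤₚ.+-*-semiring
  using (sum; sum-remove; sum-cong-≗; sum-replicate-zero; ∑-distrib-+; *-distribˡ-sum)
open import Data.List using (List; []; _∷_; filter; upTo; applyUpTo; length; foldr)
open import Data.List.Membership.Propositional using (_∈_; find; lose)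
open import Data.List.Membership.Propositional.Properties using (∈-upTo⁺; ∈-upTo⁻; ∈-filter⁺; ∈-filter⁻)
import Data.List.Properties as Listₚ
open import Data.List.Relation.Unary.All as All using (All; []; _∷_)
import Data.List.Relation.Unary.All.Properties as Allₚ
open import Data.List.Relation.Unary.AllPairs using (_∷_)
open import Data.List.Relation.Unary.Any as Any using (here; there)
open import Data.List.Relation.Unary.Any.Properties using (any⁺; any⁻)
open import Data.List.Relation.Unary.Unique.Propositional using (Unique)
import Data.List.Relation.Unary.Unique.Propositional.Properties as Uniqueₚ
open import Data.Nat as ℕ using (zero; suc; _<_; _≤_; NonZero; z≤n; s≤s; ≢-nonZero⁻¹)
import Data.Nat.Properties as ℕₚ
open import Data.Nat.Coprimality using (coprime?; coprime⇒gcd≡1; coprime-Bézout; prime⇒coprime)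
import Data.Nat.Coprimality as Coprime
open import Data.Nat.Divisibility
  using (_∤_; _∣?_; _∣0; divides; ∣-refl; ∣-trans; ∣⇒≤; 1∣_; ∣1⇒≡1; 0∣⇒≡0; ∣m⇒∣m*n; ∣n⇒∣m*n;
         m*n∣⇒m∣; m*n∣⇒n∣; *-monoʳ-∣)
open import Data.Nat.DivMod using (_%_; _/_; m%n<n; m≡m%n+[m/n]*n)
open import Data.Nat.GCD using (module Bézout)
open import Data.Nat.LCM using (lcm; lcm-least; gcd*lcm)
open import Data.Nat.ListAction using (product)
open import Data.Nat.Primality
  using (prime?; prime[2]; ¬prime[1]; euclidsLemma; prime⇒irreducible; prime⇒nonZero; prime⇒nonTrivial)
open import Data.Nat.Primality.Factorisation using (factorise; factorisationHasAllPrimeFactors)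
open import Data.Product using (∃; ∃-syntax; _,_; proj₁; proj₂)
import Data.Sum as Sum
open import Data.Sum using (_⊎_; inj₁; inj₂)
open import Data.Unit using (tt)
open import Data.Vec.Functional using (Vector)
open import Function using (_∘_)
open import Relation.Nullary using (¬_; ¬?; Dec; does; yes; no; contradiction)
open import Relation.Nullary.Decidable
  using (_×-dec_; dec-true; dec-false; toWitness; fromWitness; isYes≗does)
open import Relation.Unary using (Decidable)
open import Relation.Binary.PropositionalEquality
  using (refl; sym; trans; cong; cong₂; subst; module ≡-Reasoning)

private
  variable
    l m n o p q : ℕ
    a b c d : ℤ

-- Congruences modulo a natural number

infix 4 _≡_mod_

-- A record, so that a, b and p can be recovered from the type of a congruence.
record _≡_mod_ (a b : ℤ) (p : ℕ) : Set where
  constructor mk≡mod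
  field ∣-difference : + p ∣ᶻ a - b

open _≡_mod_

≡mod-reflexive : a ≡ b → a ≡ b mod p
≡mod-reflexive {a} {p = p} refl = mk≡mod (subst (+ p ∣ᶻ_) (sym (ℤₚ.+-inverseʳ a)) (ℤ∣.∣ᵤ⇒∣ (p ∣0)))

≡mod-refl : a ≡ a mod p
≡mod-refl = ≡mod-reflexive refl

≡mod-sym : a ≡ b mod p → b ≡ a mod p
≡mod-sym {a} {b} {p} (mk≡mod a-b) = mk≡mod (subst (+ p ∣ᶻ_) (negate a b) (ℤ∣.∣m⇒∣-m a-b))
  where
  negate : ∀ a b → - (a - b) ≡ b - a
  negate = solve-∀

≡mod-trans : a ≡ b mod p → b ≡ c mod p → a ≡ c mod p
≡mod-trans {a} {b} {p} {c} (mk≡mod a-b) (mk≡mod b-c) =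
  mk≡mod (subst (+ p ∣ᶻ_) (telescope a b c) (ℤ∣.∣m∣n⇒∣m+n a-b b-c))
  where
  telescope : ∀ a b c → (a - b) + (b - c) ≡ a - c
  telescope = solve-∀

≡mod-+ : a ≡ b mod p → c ≡ d mod p → a + c ≡ b + d mod p
≡mod-+ {a} {b} {p} {c} {d} (mk≡mod a-b) (mk≡mod c-d) =
  mk≡mod (subst (+ p ∣ᶻ_) (regroup a b c d) (ℤ∣.∣m∣n⇒∣m+n a-b c-d))
  where
  regroup : ∀ a b c d → (a - b) + (c - d) ≡ (a + c) - (b + d)
  regroup = solve-∀

≡mod-* : a ≡ b mod p → c ≡ d mod p → a * c ≡ b * d mod p
≡mod-* {a} {b} {p} {c} {d} (mk≡mod a-b) (mk≡mod c-d) =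
  mk≡mod (subst (+ p ∣ᶻ_) (regroup a b c d) (ℤ∣.∣m∣n⇒∣m+n (ℤ∣.∣m⇒∣m*n c a-b) (ℤ∣.∣n⇒∣m*n b c-d)))
  where
  regroup : ∀ a b c d → (a - b) * c + b * (c - d) ≡ a * c - b * d
  regroup = solve-∀

≡mod-∣ : a ≡ b mod p → + p ∣ᶻ b → + p ∣ᶻ a
≡mod-∣ {a} {b} {p} (mk≡mod a-b) p∣b = subst (+ p ∣ᶻ_) (cancel a b) (ℤ∣.∣m∣n⇒∣m+n a-b p∣b)
  where
  cancel : ∀ a b → (a - b) + b ≡ a
  cancel = solve-∀

∣⇒≡mod-0 : + p ∣ᶻ a → a ≡ 0ℤ mod p
∣⇒≡mod-0 {p} {a} p∣a = mk≡mod (subst (+ p ∣ᶻ_) (sym (ℤₚ.+-identityʳ a)) p∣a)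

%ℕ-≡mod : ∀ a {n} .{{_ : NonZero n}} → p ∣ n → + (a %ℕ n) ≡ a mod p
%ℕ-≡mod {p} a {n} p∣n =
  mk≡mod (subst (+ p ∣ᶻ_) (sym remainder) (ℤ∣.∣m⇒∣-m (ℤ∣.∣n⇒∣m*n (a /ℕ n) (ℤ∣.∣ᵤ⇒∣ p∣n))))
  where
  cancel : ∀ r m → r - (r + m) ≡ - m
  cancel = solve-∀
  remainder : + (a %ℕ n) - a ≡ - (a /ℕ n * + n)
  remainder = trans (cong (_-_ (+ (a %ℕ n))) (a≡a%ℕn+[a/ℕn]*n a n)) (cancel (+ (a %ℕ n)) _)

euclidsLemmaᶻ : Prime p → + p ∣ᶻ a * b → + p ∣ᶻ a ⊎ + p ∣ᶻ b
euclidsLemmaᶻ {p} {a} {b} p-prime p∣ab =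
  Sum.map ℤ∣.∣ᵤ⇒∣ ℤ∣.∣ᵤ⇒∣
    (euclidsLemma ℤ.∣ a ∣ ℤ.∣ b ∣ p-prime (subst (p ∣_) (ℤₚ.abs-* a b) (ℤ∣.∣⇒∣ᵤ p∣ab)))

prime∤1ᶻ : Prime p → ¬ + p ∣ᶻ 1ℤ
prime∤1ᶻ p-prime p∣1 = ¬prime[1] (subst Prime (∣1⇒≡1 (ℤ∣.∣⇒∣ᵤ p∣1)) p-prime)

coprime⇒∤ᶻ : ∀ {m p} → Prime p → Coprime m p → ¬ + p ∣ᶻ + m
coprime⇒∤ᶻ {p = p} p-prime coprime p∣m = ¬prime[1] (subst Prime (coprime (ℤ∣.∣⇒∣ᵤ p∣m , ∣-refl)) p-prime)

∤-* : Prime p → ¬ + p ∣ᶻ a → ¬ + p ∣ᶻ b → ¬ + p ∣ᶻ a * b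
∤-* p-prime p∤a p∤b = Sum.[ p∤a , p∤b ] ∘ euclidsLemmaᶻ p-prime

∤-≡mod : a ≡ b mod p → ¬ + p ∣ᶻ b → ¬ + p ∣ᶻ a
∤-≡mod a≡b p∤b p∣a = p∤b (≡mod-∣ (≡mod-sym a≡b) p∣a)

private
  pos-1+* : ∀ u v s t → 1 ℕ.+ u ℕ.* v ≡ s ℕ.* t → 1ℤ + + u * + v ≡ + s * + t
  pos-1+* u v s t eq =
    trans (cong (_+_ 1ℤ) (sym (ℤₚ.pos-* u v))) (trans (cong +_ eq) (ℤₚ.pos-* s t))

  bézout-inverse : ∀ {m} → Bézout.Identity 1 m p → ∃[ b ] + m * b ≡ 1ℤ mod p
  bézout-inverse {p} {m} (Bézout.+- x y 1+yp≡xm) =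
    + x , mk≡mod (subst (+ p ∣ᶻ_) yp≡mx-1 (ℤ∣.∣n⇒∣m*n (+ y) ℤ∣.∣-refl))
    where
    undo : ∀ s → s ≡ (1ℤ + s) - 1ℤ
    undo = solve-∀
    yp≡mx-1 : + y * + p ≡ + m * + x - 1ℤ
    yp≡mx-1 = trans (undo (+ y * + p))
      (cong (_- 1ℤ) (trans (pos-1+* y p x m 1+yp≡xm) (ℤₚ.*-comm (+ x) (+ m))))
  bézout-inverse {p} {m} (Bézout.-+ x y 1+xm≡yp) =
    - + x , mk≡mod (subst (+ p ∣ᶻ_) -yp≡m[-x]-1 (ℤ∣.∣m⇒∣-m (ℤ∣.∣n⇒∣m*n (+ y) ℤ∣.∣-refl)))
    where
    negate : ∀ x m → - (1ℤ + x * m) ≡ m * - x - 1ℤ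
    negate = solve-∀
    -yp≡m[-x]-1 : - (+ y * + p) ≡ + m * - + x - 1ℤ
    -yp≡m[-x]-1 = trans (cong -_ (sym (pos-1+* x m y p 1+xm≡yp))) (negate (+ x) (+ m))

inverse-mod : Prime p → ¬ + p ∣ᶻ a → ∃[ b ] a * b ≡ 1ℤ mod p
inverse-mod {p} {a} p-prime p∤a with a %ℕ p | %ℕ-≡mod {p} a (∣-refl {p}) | n%ℕd<d a p
  where
  instance
    p-nonZero : NonZero p
    p-nonZero = prime⇒nonZero p-prime
... | zero | 0≡a | _ = ⊥-elim (p∤a (≡mod-∣ (≡mod-sym 0≡a) (ℤ∣.∣ᵤ⇒∣ (p ∣0))))
... | m@(suc _) | m≡a | m<p
  with bézout-inverse (coprime-Bézout (Coprime.sym (prime⇒coprime p-prime m<p)))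
... | b , mb≡1 = b , ≡mod-trans (≡mod-* (≡mod-sym m≡a) ≡mod-refl) mb≡1

-- Unit-weighted zero sums modulo a prime

sum-≡mod : {f g : Vector ℤ l} → (∀ k → f k ≡ g k mod p) → sum f ≡ sum g mod p
sum-≡mod {zero} f≡g = ≡mod-refl
sum-≡mod {suc l} f≡g = ≡mod-+ (f≡g Fin.zero) (sum-≡mod (f≡g ∘ Fin.suc))

+-sumFin : ∀ l (f : Fin l → ℕ) → + sumFin l f ≡ sum (λ k → + f k)
+-sumFin zero    f = refl
+-sumFin (suc l) f =
  trans (ℤₚ.pos-+ (f Fin.zero) _) (cong (_+_ (+ f Fin.zero)) (+-sumFin l (f ∘ Fin.suc)))

single : Fin l → ℤ → Vector ℤ l
single i c k = if does (k ≟ i) then c else 0ℤ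

single-≡ : ∀ (i : Fin l) c → single i c i ≡ c
single-≡ i c rewrite dec-true (i ≟ i) refl = refl

single-≢ : ∀ {i k : Fin l} c → k ≢ i → single i c k ≡ 0ℤ
single-≢ {i = i} {k} c k≢i rewrite dec-false (k ≟ i) k≢i = refl

sum-single : ∀ (i : Fin l) c → sum (single i c) ≡ c
sum-single {suc l} i c = begin
  sum (single i c)                                ≡⟨ sum-remove {i = i} (single i c) ⟩
  single i c i + sum (single i c ∘ Fin.punchIn i)  ≡⟨ cong₂ _+_ (single-≡ i c) (sum-cong-≗ off-i) ⟩
  c + sum {l} (λ _ → 0ℤ)                           ≡⟨ cong (_+_ c) (sum-replicate-zero l) ⟩
  c + 0ℤ                                          ≡⟨ ℤₚ.+-identityʳ c ⟩
  c                                               ∎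
  where
  open ≡-Reasoning
  off-i : ∀ k → single i c (Fin.punchIn i k) ≡ 0ℤ
  off-i k = single-≢ c (Finₚ.punchInᵢ≢i i k)

single-* : ∀ (i : Fin l) c (x : Vector ℤ l) k → single i c k * x k ≡ single i (c * x i) k
single-* i c x k with k ≟ i
... | yes refl = refl
... | no _ = refl

UnitWeightedZeroSum : ℕ → Vector ℤ l → Vector ℤ l → Set
UnitWeightedZeroSum p x w = (∀ k → ¬ + p ∣ᶻ w k) × sum (λ k → w k * x k) ≡ 0ℤ mod p

-- cⱼ = −Y xⱼ⁻¹ makes the weighted sum vanish, and the weight 1 + cⱼ at j is a unit
-- exactly when xⱼ ≢ Y.
private
  module Rebalance {p l} (p-prime : Prime p) (x : Vector ℤ l) {i j : Fin l} (i≢j : i ≢ j)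
                   {e : ℤ} (xⱼe≡1 : x j * e ≡ 1ℤ mod p) (cᵢ : ℤ) where

    Y : ℤ
    Y = sum x + cᵢ * x i

    cⱼ : ℤ
    cⱼ = - (Y * e)

    w : Vector ℤ l
    w k = 1ℤ + single i cᵢ k + single j cⱼ k

    weighted-sum : sum (λ k → w k * x k) ≡ Y + cⱼ * x j
    weighted-sum = begin
      sum (λ k → w k * x k)
        ≡⟨ sum-cong-≗ expand ⟩
      sum (λ k → x k + single i (cᵢ * x i) k + single j (cⱼ * x j) k)
        ≡⟨ ∑-distrib-+ (λ k → x k + single i (cᵢ * x i) k) (single j (cⱼ * x j)) ⟩
      sum (λ k → x k + single i (cᵢ * x i) k) + sum (single j (cⱼ * x j))
        ≡⟨ cong₂ _+_ (∑-distrib-+ x (single i (cᵢ * x i))) (sum-single j (cⱼ * x j)) ⟩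
      sum x + sum (single i (cᵢ * x i)) + cⱼ * x j
        ≡⟨ cong (λ s → sum x + s + cⱼ * x j) (sum-single i (cᵢ * x i)) ⟩
      Y + cⱼ * x j ∎
      where
      open ≡-Reasoning
      distrib : ∀ s t z → (1ℤ + s + t) * z ≡ z + s * z + t * z
      distrib = solve-∀
      expand : ∀ k → w k * x k ≡ x k + single i (cᵢ * x i) k + single j (cⱼ * x j) k
      expand k = trans (distrib (single i cᵢ k) (single j cⱼ k) (x k))
                       (cong₂ (λ s t → x k + s + t) (single-* i cᵢ x k) (single-* j cⱼ x k))

    zero-sum : sum (λ k → w k * x k) ≡ 0ℤ mod p
    zero-sum = ∣⇒≡mod-0 (subst (+ p ∣ᶻ_) (trans (factor Y (x j) e) (sym weighted-sum))
                                (ℤ∣.∣m⇒∣-m (ℤ∣.∣n⇒∣m*n Y (∣-difference xⱼe≡1))))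
      where
      factor : ∀ y z e → - (y * (z * e - 1ℤ)) ≡ y + - (y * e) * z
      factor = solve-∀

    w-at-i : w i ≡ 1ℤ + cᵢ
    w-at-i = trans (cong₂ (λ s t → 1ℤ + s + t) (single-≡ i cᵢ) (single-≢ cⱼ i≢j))
                   (ℤₚ.+-identityʳ (1ℤ + cᵢ))

    w-at-j : w j ≡ 1ℤ + cⱼ
    w-at-j = trans (cong₂ (λ s t → 1ℤ + s + t) (single-≢ cᵢ (i≢j ∘ sym)) (single-≡ j cⱼ))
                   (cong (_+ cⱼ) (ℤₚ.+-identityʳ 1ℤ))

    w-elsewhere : ∀ {k} → k ≢ i → k ≢ j → w k ≡ 1ℤ
    w-elsewhere k≢i k≢j = cong₂ (λ s t → 1ℤ + s + t) (single-≢ cᵢ k≢i) (single-≢ cⱼ k≢j)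

    w-unit : ¬ + p ∣ᶻ 1ℤ + cᵢ → ¬ + p ∣ᶻ x j - Y → ∀ k → ¬ + p ∣ᶻ w k
    w-unit p∤1+cᵢ p∤xⱼ-Y k = by-position (k ≟ i) (k ≟ j)
      where
      recombine : ∀ z y e → z * (1ℤ + - (y * e)) + y * (z * e - 1ℤ) ≡ z - y
      recombine = solve-∀
      by-position : Dec (k ≡ i) → Dec (k ≡ j) → ¬ + p ∣ᶻ w k
      by-position (yes refl) _ = subst (λ z → ¬ + p ∣ᶻ z) (sym w-at-i) p∤1+cᵢ
      by-position (no _) (yes refl) p∣wⱼ =
        p∤xⱼ-Y (subst (+ p ∣ᶻ_) (recombine (x j) Y e)
                 (ℤ∣.∣m∣n⇒∣m+n (ℤ∣.∣n⇒∣m*n (x j) (subst (+ p ∣ᶻ_) w-at-j p∣wⱼ))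
                            (ℤ∣.∣n⇒∣m*n Y (∣-difference xⱼe≡1))))
      by-position (no k≢i) (no k≢j) =
        subst (λ z → ¬ + p ∣ᶻ z) (sym (w-elsewhere k≢i k≢j)) (prime∤1ᶻ p-prime)

-- cᵢ = 0 works unless xⱼ ≡ Σ x; then cᵢ = 1 does, since 1 + cᵢ = 2 is a unit (p odd) and
-- xⱼ ≢ Σ x + xᵢ as xᵢ is a unit.
two-units⇒unitWeightedZeroSum : Prime p → p ∤ 2 → (x : Vector ℤ l) → {i j : Fin l} → i ≢ j →
  ¬ + p ∣ᶻ x i → ¬ + p ∣ᶻ x j → ∃ (UnitWeightedZeroSum p x)
two-units⇒unitWeightedZeroSum {p} p-prime p∤2 x {i} {j} i≢j p∤xᵢ p∤xⱼ
  with inverse-mod p-prime p∤xⱼ | + p ∣ᶻ? x j - sum x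
... | e , xⱼe≡1 | no p∤xⱼ-X = w , w-unit (prime∤1ᶻ p-prime) p∤xⱼ-Y , zero-sum
  where
  open Rebalance p-prime x i≢j xⱼe≡1 0ℤ
  p∤xⱼ-Y : ¬ + p ∣ᶻ x j - Y
  p∤xⱼ-Y = subst (λ z → ¬ + p ∣ᶻ z) (cong (λ y → x j - y) (sym (ℤₚ.+-identityʳ (sum x)))) p∤xⱼ-X
... | e , xⱼe≡1 | yes p∣xⱼ-X = w , w-unit (p∤2 ∘ ℤ∣.∣⇒∣ᵤ) p∤xⱼ-Y , zero-sum
  where
  open Rebalance p-prime x i≢j xⱼe≡1 1ℤ
  difference : ∀ z s y → (z - s) - (z - (s + 1ℤ * y)) ≡ y
  difference = solve-∀
  p∤xⱼ-Y : ¬ + p ∣ᶻ x j - Y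
  p∤xⱼ-Y p∣xⱼ-Y = p∤xᵢ (subst (+ p ∣ᶻ_) (difference (x j) (sum x) (x i)) (ℤ∣.∣m∣n⇒∣m-n p∣xⱼ-X p∣xⱼ-Y))

normalise-weight : Prime p → {x w : Vector ℤ l} → UnitWeightedZeroSum p x w →
  ∀ u → ∃[ w′ ] UnitWeightedZeroSum p x w′ × w′ u ≡ 1ℤ mod p
normalise-weight {p} p-prime {x} {w} (p∤w , zero-sum) u with inverse-mod p-prime (p∤w u)
... | f , wᵤf≡1 = (λ k → w k * f) , ((λ k → ∤-* p-prime (p∤w k) p∤f) , scaled-zero-sum) , wᵤf≡1
  where
  p∤f : ¬ + p ∣ᶻ f
  p∤f p∣f = prime∤1ᶻ p-prime (≡mod-∣ (≡mod-sym wᵤf≡1) (ℤ∣.∣n⇒∣m*n (w u) p∣f))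
  swap : ∀ a b c → a * b * c ≡ b * (a * c)
  swap = solve-∀
  scaled-zero-sum : sum (λ k → w k * f * x k) ≡ 0ℤ mod p
  scaled-zero-sum = ≡mod-trans
    (≡mod-reflexive (trans (sum-cong-≗ (λ k → swap (w k) f (x k)))
                           (sym (*-distribˡ-sum f (λ k → w k * x k)))))
    (≡mod-trans (≡mod-* (≡mod-refl {f}) zero-sum) (≡mod-reflexive (ℤₚ.*-zeroʳ f)))

unitWeightedZeroSum-with-1-at : Prime p → p ∤ 2 → (x : Vector ℤ l) → {i j : Fin l} → i ≢ j →
  ¬ + p ∣ᶻ x i → ¬ + p ∣ᶻ x j → {U : Fin l → Set} → Decidable U → (∀ k k′ → U k → U k′ → k ≡ k′) →
  ∃[ w ] UnitWeightedZeroSum p x w × (∀ k → U k → w k ≡ 1ℤ mod p)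
unitWeightedZeroSum-with-1-at {p} p-prime p∤2 x i≢j p∤xᵢ p∤xⱼ {U} U? at-most-one =
  normalise (two-units⇒unitWeightedZeroSum p-prime p∤2 x i≢j p∤xᵢ p∤xⱼ) (Finₚ.any? U?)
  where
  normalise : ∃ (UnitWeightedZeroSum p x) → Dec (∃ U) →
    ∃[ w ] UnitWeightedZeroSum p x w × (∀ k → U k → w k ≡ 1ℤ mod p)
  normalise (w , w-ok) (no ¬∃U) = w , w-ok , λ k Uk → ⊥-elim (¬∃U (k , Uk))
  normalise (w , w-ok) (yes (u , Uu)) =
    let (w′ , w′-ok , w′ᵤ≡1) = normalise-weight p-prime w-ok u
    in w′ , w′-ok , λ k Uk → subst (λ k → w′ k ≡ 1ℤ mod p) (at-most-one u k Uu Uk) w′ᵤ≡1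

-- Legendre symbols and quadratic non-residues

∣m⊖n∣≡∣m-n∣ : ∀ m n → ℤ.∣ m ⊖ n ∣ ≡ ℕ.∣ m - n ∣
∣m⊖n∣≡∣m-n∣ zero    zero    = refl
∣m⊖n∣≡∣m-n∣ zero    (suc n) = refl
∣m⊖n∣≡∣m-n∣ (suc m) zero    = refl
∣m⊖n∣≡∣m-n∣ (suc m) (suc n) = trans (cong ℤ.∣_∣ (ℤₚ.[1+m]⊖[1+n]≡m⊖n m n)) (∣m⊖n∣≡∣m-n∣ m n)

private
  ∣+m-+n∣≡∣m-n∣ : ∀ m n → ℤ.∣ + m - + n ∣ ≡ ℕ.∣ m - n ∣
  ∣+m-+n∣≡∣m-n∣ m n = trans (cong ℤ.∣_∣ (ℤₚ.[+m]-[+n]≡m⊖n m n)) (∣m⊖n∣≡∣m-n∣ m n)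

∣∣m-n∣⇒≡mod : ∀ m n → p ∣ ℕ.∣ m - n ∣ → + m ≡ + n mod p
∣∣m-n∣⇒≡mod {p} m n p∣ = mk≡mod (ℤ∣.∣ᵤ⇒∣ (subst (p ∣_) (sym (∣+m-+n∣≡∣m-n∣ m n)) p∣))

≡mod⇒∣∣m-n∣ : ∀ m n → + m ≡ + n mod p → p ∣ ℕ.∣ m - n ∣
≡mod⇒∣∣m-n∣ {p} m n (mk≡mod p∣) = subst (p ∣_) (∣+m-+n∣≡∣m-n∣ m n) (ℤ∣.∣⇒∣ᵤ p∣)

SquareRootMod : ℕ → ℕ → ℕ → Set
SquareRootMod p m y = + (y ℕ.* y) ≡ + m mod p

isQR-sound : T (isQR p m) → ∃[ y ] y < p × SquareRootMod p m y
isQR-sound {p} {m} qr with find (any⁻ _ (upTo p) qr)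
... | y , y∈ , hit = y , ∈-upTo⁻ y∈ ,
  ∣∣m-n∣⇒≡mod _ m (toWitness (subst T (sym (isYes≗does (p ∣? ℕ.∣ y ℕ.* y - m ∣))) hit))

isQR-complete : ∀ {y} → y < p → SquareRootMod p m y → T (isQR p m)
isQR-complete {p} {m} {y} y<p root =
  any⁺ _ (lose (∈-upTo⁺ y<p) (subst T (isYes≗does (p ∣? ℕ.∣ y ℕ.* y - m ∣))
                                        (fromWitness (≡mod⇒∣∣m-n∣ (y ℕ.* y) m root))))

isQR-≡mod : + m ≡ + n mod p → T (isQR p m) → T (isQR p n)
isQR-≡mod m≡n qr with isQR-sound qr
... | y , y<p , root = isQR-complete y<p (≡mod-trans root m≡n)

legendre-residue : ∀ {y} → y < p → SquareRootMod p m y → legendre p m ≡ 1ℤ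
legendre-residue {p} {m} y<p root with isQR p m | isQR-complete {p} {m} y<p root
... | true | _ = refl

legendre-1 : Prime p → legendre p 1 ≡ 1ℤ
legendre-1 {p} p-prime = legendre-residue (ℕ.nonTrivial⇒n>1 p {{prime⇒nonTrivial p-prime}}) ≡mod-refl

legendre-nonresidue : (∀ y → y < p → ¬ SquareRootMod p m y) → legendre p m ≡ -1ℤ
legendre-nonresidue {p} {m} no-root with isQR p m in qr
... | false = refl
... | true with isQR-sound {p} {m} (subst T (sym qr) tt)
...   | y , y<p , root = contradiction root (no-root y y<p)

legendre-≡mod : + m ≡ + n mod p → legendre p m ≡ legendre p n
legendre-≡mod {m} {n} {p} m≡n with isQR p m in qm | isQR p n in qn
... | true  | true  = refl
... | false | false = refl
... | true  | false = ⊥-elim (subst T qn (isQR-≡mod m≡n (subst T (sym qm) tt)))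
... | false | true  = ⊥-elim (subst T qm (isQR-≡mod (≡mod-sym m≡n) (subst T (sym qn) tt)))

legendre≡±1 : ∀ p m → legendre p m ≡ 1ℤ ⊎ legendre p m ≡ -1ℤ
legendre≡±1 p m with isQR p m
... | true  = inj₁ refl
... | false = inj₂ refl

≡mod⇒≡ : m < p → n < p → + m ≡ + n mod p → m ≡ n
≡mod⇒≡ {m} {p} {n} m<p n<p m≡n with ℕ.∣ m - n ∣ in eq | ≡mod⇒∣∣m-n∣ {p} m n m≡n
... | zero  | _   = ℕₚ.∣m-n∣≡0⇒m≡n eq
... | suc _ | p∣ = contradiction (∣⇒≤ p∣)
  (ℕₚ.<⇒≱ (subst (_< p) eq (ℕₚ.≤-<-trans (ℕₚ.∣m-n∣≤m⊔n m n) (ℕₚ.⊔-lub m<p n<p))))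

non-surjective : ∀ {k n} → k < n → (f : Fin k → Fin n) → ∃[ c ] ∀ y → f y ≢ c
non-surjective {k} {n} k<n f with Finₚ.all? (λ c → Finₚ.any? (λ y → f y ≟ c))
... | no ¬all-hit =
  let (c , c-missed) = Finₚ.¬∀⟶∃¬ n _ (λ c → Finₚ.any? (λ y → f y ≟ c)) ¬all-hit
  in c , λ y fy≡c → c-missed (y , fy≡c)
... | yes all-hit with Finₚ.pigeonhole k<n (proj₁ ∘ all-hit)
...   | i , j , i<j , same-preimage = contradiction
  (trans (sym (proj₂ (all-hit i))) (trans (cong f same-preimage) (proj₂ (all-hit j))))
  (Finₚ.<⇒≢ i<j)

odd-prime⇒≡1+2k : Prime p → p ∤ 2 → ∃[ k ] p ≡ suc (k ℕ.+ k) × 1 ≤ k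
odd-prime⇒≡1+2k {p} p-prime p∤2 with p % 2 | m%n<n p 2 | m≡m%n+[m/n]*n p 2
... | zero | _ | p≡[p/2]*2 with prime⇒irreducible p-prime (divides (p / 2) p≡[p/2]*2)
...   | inj₁ ()
...   | inj₂ refl = contradiction ∣-refl p∤2
odd-prime⇒≡1+2k {p} p-prime p∤2 | suc zero | _ | p≡1+[p/2]*2 with p / 2
... | zero  = contradiction (subst Prime p≡1+[p/2]*2 p-prime) ¬prime[1]
... | suc k = suc k , trans p≡1+[p/2]*2 (cong suc (solve-k k)) , s≤s z≤n
  where
  solve-k : ∀ k → suc k ℕ.* 2 ≡ suc k ℕ.+ suc k
  solve-k k = trans (ℕₚ.*-comm (suc k) 2) (cong (suc k ℕ.+_) (ℕₚ.+-identityʳ (suc k)))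
odd-prime⇒≡1+2k p-prime p∤2 | suc (suc _) | s≤s (s≤s ()) | _

[p∸y]²≡y² : ∀ {p y} → y ≤ p → SquareRootMod p (y ℕ.* y) (p ℕ.∸ y)
[p∸y]²≡y² {p} {y} y≤p = mk≡mod (subst (+ p ∣ᶻ_) difference (ℤ∣.∣m⇒∣m*n (+ p - + y - + y) ℤ∣.∣-refl))
  where
  +[p∸y] : + (p ℕ.∸ y) ≡ + p - + y
  +[p∸y] = sym (trans (ℤₚ.[+m]-[+n]≡m⊖n p y) (ℤₚ.⊖-≥ y≤p))
  expand : ∀ p y → p * (p - y - y) ≡ (p - y) * (p - y) - y * y
  expand = solve-∀
  difference : + p * (+ p - + y - + y) ≡ + ((p ℕ.∸ y) ℕ.* (p ℕ.∸ y)) - + (y ℕ.* y)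
  difference = trans (expand (+ p) (+ y)) (cong₂ _-_
    (trans (cong₂ _*_ (sym +[p∸y]) (sym +[p∸y])) (sym (ℤₚ.pos-* (p ℕ.∸ y) (p ℕ.∸ y))))
    (sym (ℤₚ.pos-* y y)))

-- The squares of 0, …, k take at most k + 1 < p values mod p, and every square is
-- among them since (p − y)² ≡ y².
nonresidue : Prime p → p ∤ 2 → ∃[ c ] ¬ + p ∣ᶻ + c × (∀ y → y < p → ¬ SquareRootMod p c y)
nonresidue {p} p-prime p∤2 with odd-prime⇒≡1+2k p-prime p∤2
... | k , refl , 1≤k = toℕ missed , missed-unit , no-root
  where
  square : Fin (suc k) → Fin p
  square y = fromℕ< (m%n<n (toℕ y ℕ.* toℕ y) p)
  k<half : suc k < p
  k<half = s≤s (subst (_≤ k ℕ.+ k) (ℕₚ.+-comm k 1) (ℕₚ.+-monoʳ-≤ k 1≤k))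
  missed : Fin p
  missed = proj₁ (non-surjective k<half square)
  no-small-root : ∀ z → z ≤ k → ¬ SquareRootMod p (toℕ missed) z
  no-small-root z z≤k root = proj₂ (non-surjective k<half square) (fromℕ< (s≤s z≤k))
    (Finₚ.toℕ-injective (begin
      toℕ (square (fromℕ< (s≤s z≤k)))       ≡⟨ Finₚ.toℕ-fromℕ< _ ⟩
      toℕ (fromℕ< (s≤s z≤k)) ℕ.* toℕ (fromℕ< (s≤s z≤k)) % p
                                            ≡⟨ cong (λ w → w ℕ.* w % p) (Finₚ.toℕ-fromℕ< (s≤s z≤k)) ⟩
      z ℕ.* z % p                           ≡⟨ ≡mod⇒≡ (m%n<n (z ℕ.* z) p) (Finₚ.toℕ<n missed)
                                                 (≡mod-trans (%ℕ-≡mod (+ (z ℕ.* z)) ∣-refl) root) ⟩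
      toℕ missed                            ∎))
    where
    open ≡-Reasoning
  no-root : ∀ y → y < p → ¬ SquareRootMod p (toℕ missed) y
  no-root y y<p with y ℕ.≤? k
  ... | yes y≤k = no-small-root y y≤k
  ... | no y≰k = no-small-root (p ℕ.∸ y) p∸y≤k ∘ ≡mod-trans ([p∸y]²≡y² (ℕₚ.<⇒≤ y<p))
    where
    p∸y≤k : p ℕ.∸ y ≤ k
    p∸y≤k = ℕₚ.≤-trans (ℕₚ.∸-monoʳ-≤ p (ℕₚ.≰⇒> y≰k)) (ℕₚ.≤-reflexive (ℕₚ.m+n∸n≡m k k))
  missed-unit : ¬ + p ∣ᶻ + toℕ missed
  missed-unit p∣missed = no-small-root 0 z≤n (≡mod-sym (∣⇒≡mod-0 p∣missed))

-- Squarefree moduli and the Chinese remainder theorem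

prime∤⇒coprime : Prime p → p ∤ m → Coprime p m
prime∤⇒coprime p-prime p∤m (d∣p , d∣m) with prime⇒irreducible p-prime d∣p
... | inj₁ d≡1 = d≡1
... | inj₂ refl = contradiction d∣m p∤m

coprime⇒*∣ : Coprime m n → m ∣ o → n ∣ o → m ℕ.* n ∣ o
coprime⇒*∣ {m} {n} {o} coprime m∣o n∣o = subst (_∣ o) lcm≡m*n (lcm-least m∣o n∣o)
  where
  lcm≡m*n : lcm m n ≡ m ℕ.* n
  lcm≡m*n = trans (sym (ℕₚ.*-identityˡ (lcm m n)))
                  (trans (cong (ℕ._* lcm m n) (sym (coprime⇒gcd≡1 coprime))) (gcd*lcm m n))

∃-prime-divisor : 2 ≤ m → ∃[ q ] Prime q × q ∣ m
∃-prime-divisor {m@(suc _)} 2≤m with factorise m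
... | record { factors = [] ; isFactorisation = m≡1 } = contradiction (sym m≡1) (ℕₚ.<⇒≢ 2≤m)
... | record { factors = q ∷ qs ; isFactorisation = m≡q*∏qs ; factorsPrime = q-prime ∷ _ } =
  q , q-prime , subst (q ∣_) (sym m≡q*∏qs) (∣m⇒∣m*n (product qs) ∣-refl)

coprime-by-primes : n ≢ 0 → (∀ p → Prime p → p ∣ n → p ∤ m) → Coprime m n
coprime-by-primes n≢0 no-common {zero} (_ , 0∣n) = contradiction (0∣⇒≡0 0∣n) n≢0
coprime-by-primes n≢0 no-common {suc zero} _ = refl
coprime-by-primes n≢0 no-common {suc (suc d)} (d∣m , d∣n) with ∃-prime-divisor (s≤s (s≤s z≤n))
... | q , q-prime , q∣d = contradiction (∣-trans q∣d d∣m) (no-common q q-prime (∣-trans q∣d d∣n))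

∈-primeDivisors⁺ : .{{NonZero n}} → Prime p → p ∣ n → p ∈ primeDivisors n
∈-primeDivisors⁺ {n} p-prime p∣n =
  ∈-filter⁺ (λ p → prime? p ×-dec (p ∣? n)) (∈-upTo⁺ (s≤s (∣⇒≤ p∣n))) (p-prime , p∣n)

∈-primeDivisors⁻ : p ∈ primeDivisors n → Prime p × p ∣ n
∈-primeDivisors⁻ {n = n} = proj₂ ∘ ∈-filter⁻ (λ p → prime? p ×-dec (p ∣? n)) {xs = upTo (suc n)}

primeDivisors-unique : ∀ n → Unique (primeDivisors n)
primeDivisors-unique n = Uniqueₚ.filter⁺ (λ p → prime? p ×-dec (p ∣? n)) (Uniqueₚ.upTo⁺ (suc n))

primeDivisors-prime : ∀ n → All Prime (primeDivisors n)
primeDivisors-prime n = All.tabulate (proj₁ ∘ ∈-primeDivisors⁻ {n = n})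

squarefree⇒multiplicity≡1 : Squarefree n → Prime p → p ∣ n → multiplicity p n ≡ 1
squarefree⇒multiplicity≡1 {zero} sqf _ _ = contradiction (4 ∣0) (sqf 2 prime[2])
squarefree⇒multiplicity≡1 {suc n} {p} sqf p-prime p∣n = cong length (begin
  filter (λ k → (p ℕ.^ k) ∣? suc n) (1 ∷ applyUpTo (suc ∘ suc) n)
    ≡⟨ Listₚ.filter-accept (λ k → (p ℕ.^ k) ∣? suc n) (subst (_∣ suc n) (sym (ℕₚ.*-identityʳ p)) p∣n) ⟩
  1 ∷ filter (λ k → (p ℕ.^ k) ∣? suc n) (applyUpTo (suc ∘ suc) n)
    ≡⟨ cong (1 ∷_) (Listₚ.filter-none (λ k → (p ℕ.^ k) ∣? suc n)
                      (Allₚ.applyUpTo⁺₂ (suc ∘ suc) n p²∤)) ⟩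
  1 ∷ [] ∎)
  where
  open ≡-Reasoning
  p²∤ : ∀ k → p ℕ.^ suc (suc k) ∤ suc n
  p²∤ k p^[2+k]∣n = sqf p p-prime (∣-trans (divides (p ℕ.^ k) p^[2+k]≡p^k*p²) p^[2+k]∣n)
    where
    p^[2+k]≡p^k*p² : p ℕ.^ suc (suc k) ≡ p ℕ.^ k ℕ.* (p ℕ.* p)
    p^[2+k]≡p^k*p² = trans (sym (ℕₚ.*-assoc p p (p ℕ.^ k))) (ℕₚ.*-comm (p ℕ.* p) (p ℕ.^ k))

squarefree⇒∣ : Squarefree n → (∀ p → Prime p → p ∣ n → p ∣ m) → n ∣ m
squarefree⇒∣ {zero} sqf _ = contradiction (4 ∣0) (sqf 2 prime[2])
squarefree⇒∣ {n@(suc _)} {m} sqf prime-divisors∣m with factorise n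
... | record { factors = qs ; isFactorisation = n≡∏qs ; factorsPrime = qs-prime } =
  subst (_∣ m) (sym n≡∏qs) (∏∣m qs qs-prime (subst (_∣ n) n≡∏qs ∣-refl))
  where
  ∏∣m : ∀ qs → All Prime qs → product qs ∣ n → product qs ∣ m
  ∏∣m [] _ _ = 1∣ m
  ∏∣m (q ∷ qs) (q-prime ∷ qs-prime) q*∏qs∣n =
    coprime⇒*∣ (prime∤⇒coprime q-prime q∤∏qs)
               (prime-divisors∣m q q-prime (m*n∣⇒m∣ q (product qs) q*∏qs∣n))
               (∏∣m qs qs-prime (m*n∣⇒n∣ q (product qs) q*∏qs∣n))
    where
    q∤∏qs : q ∤ product qs
    q∤∏qs q∣∏qs = sqf q q-prime (∣-trans (*-monoʳ-∣ q q∣∏qs) q*∏qs∣n)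

∏ : List ℕ → (ℕ → ℤ) → ℤ
∏ ps f = foldr (λ p acc → f p * acc) 1ℤ ps

∏-cong : ∀ ps {f g : ℕ → ℤ} → (∀ {p} → p ∈ ps → f p ≡ g p) → ∏ ps f ≡ ∏ ps g
∏-cong []       f≡g = refl
∏-cong (p ∷ ps) f≡g = cong₂ _*_ (f≡g (here refl)) (∏-cong ps (f≡g ∘ there))

∏≡1 : ∀ ps {f : ℕ → ℤ} → (∀ {p} → p ∈ ps → f p ≡ 1ℤ) → ∏ ps f ≡ 1ℤ
∏≡1 []       f≡1 = refl
∏≡1 (p ∷ ps) f≡1 = cong₂ _*_ (f≡1 (here refl)) (∏≡1 ps (f≡1 ∘ there))

∏≡±1 : ∀ ps {f : ℕ → ℤ} → (∀ p → f p ≡ 1ℤ ⊎ f p ≡ -1ℤ) → ∏ ps f ≡ 1ℤ ⊎ ∏ ps f ≡ -1ℤ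
∏≡±1 []       f≡±1 = inj₁ refl
∏≡±1 (p ∷ ps) {f} f≡±1 with f p | f≡±1 p | ∏ ps f | ∏≡±1 ps f≡±1
... | _ | inj₁ refl | _ | inj₁ refl = inj₁ refl
... | _ | inj₁ refl | _ | inj₂ refl = inj₂ refl
... | _ | inj₂ refl | _ | inj₁ refl = inj₂ refl
... | _ | inj₂ refl | _ | inj₂ refl = inj₁ refl

others : ℕ → List ℕ → List ℕ
others q = filter (λ p → ¬? (p ℕₚ.≟ q))

∏-split : ∀ {ps q} (f : ℕ → ℤ) → Unique ps → q ∈ ps → ∏ ps f ≡ f q * ∏ (others q ps) f
∏-split {p ∷ ps} f (p∉ps ∷ _) (here refl)
  rewrite Listₚ.filter-reject (λ z → ¬? (z ℕₚ.≟ p)) {x = p} {xs = ps} (λ p≢p → p≢p refl)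
        | Listₚ.filter-all (λ z → ¬? (z ℕₚ.≟ p)) {xs = ps} (All.map (λ p≢z z≡p → p≢z (sym z≡p)) p∉ps)
  = refl
∏-split {p ∷ ps} {q} f (p∉ps ∷ ps-unique) (there q∈ps)
  rewrite Listₚ.filter-accept (λ z → ¬? (z ℕₚ.≟ q)) {x = p} {xs = ps}
            (λ p≡q → All.lookup p∉ps (subst (_∈ ps) (sym p≡q) q∈ps) refl)
        | ∏-split f ps-unique q∈ps
  = swap (f p) (f q) _
  where
  swap : ∀ a b c → a * (b * c) ≡ b * (a * c)
  swap = solve-∀

jacobi-squarefree : Squarefree n → ∀ a → jacobi n a ≡ ∏ (primeDivisors n) (λ p → legendre p a)
jacobi-squarefree {n} sqf a =
  go (primeDivisors n) (All.tabulate λ p∈ → let (p-prime , p∣n) = ∈-primeDivisors⁻ {n = n} p∈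
                                            in squarefree⇒multiplicity≡1 sqf p-prime p∣n)
  where
  go : ∀ ps → All (λ p → multiplicity p n ≡ 1) ps →
       foldr (λ p acc → legendre p a ℤ.^ multiplicity p n * acc) 1ℤ ps ≡ ∏ ps (λ p → legendre p a)
  go []       []               = refl
  go (p ∷ ps) (mult≡1 ∷ mults) rewrite mult≡1 =
    cong₂ _*_ (ℤₚ.*-identityʳ (legendre p a)) (go ps mults)

∈⇒∣product : ∀ {q ps} → q ∈ ps → q ∣ product ps
∈⇒∣product {ps = p ∷ ps} (here refl) = ∣m⇒∣m*n (product ps) ∣-refl
∈⇒∣product {ps = p ∷ ps} (there q∈ps) = ∣n⇒∣m*n p (∈⇒∣product q∈ps)

chineseRemainder : ∀ {ps} → Unique ps → All Prime ps → (r : ℕ → ℤ) →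
  ∃[ a ] ∀ {p} → p ∈ ps → a ≡ r p mod p
chineseRemainder {[]} _ _ r = 0ℤ , λ ()
chineseRemainder {p ∷ ps} (p∉ps ∷ ps-unique) (p-prime ∷ ps-prime) r
  with chineseRemainder ps-unique ps-prime r | inverse-mod p-prime p∤∏ps
  where
  p∤∏ps : ¬ + p ∣ᶻ + product ps
  p∤∏ps p∣∏ps = All.lookup p∉ps (factorisationHasAllPrimeFactors p-prime (ℤ∣.∣⇒∣ᵤ p∣∏ps) ps-prime) refl
... | a , a≡r | e , ∏ps*e≡1 = a + M * e * (r p - a) , solves
  where
  M : ℤ
  M = + product ps
  solves : ∀ {q} → q ∈ p ∷ ps → a + M * e * (r p - a) ≡ r q mod q
  solves (here refl) =
    mk≡mod (subst (+ p ∣ᶻ_) (rearrange a (r p) M e) (ℤ∣.∣m⇒∣m*n (r p - a) (∣-difference ∏ps*e≡1)))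
    where
    rearrange : ∀ a s m e → (m * e - 1ℤ) * (s - a) ≡ (a + m * e * (s - a)) - s
    rearrange = solve-∀
  solves {q} (there q∈ps) = mk≡mod (subst (+ q ∣ᶻ_) (rearrange a (r q) (M * e * (r p - a)))
    (ℤ∣.∣m∣n⇒∣m+n (∣-difference (a≡r q∈ps))
                  (ℤ∣.∣m⇒∣m*n (r p - a) (ℤ∣.∣m⇒∣m*n e (ℤ∣.∣ᵤ⇒∣ {i = M} (∈⇒∣product q∈ps))))))
    where
    rearrange : ∀ a s t → (a - s) + t ≡ (a + t) - s
    rearrange = solve-∀

-- Weights in S(n)

module SquarefreeOdd (n : ℕ) {{_ : NonZero n}} (sqf : Squarefree n) (n-odd : Odd n) where

  ps : List ℕ
  ps = primeDivisors n

  ∈ps⇒odd : p ∈ ps → p ∤ 2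
  ∈ps⇒odd {p} p∈ps p∣2 with ∈-primeDivisors⁻ {n = n} p∈ps | prime⇒irreducible prime[2] p∣2
  ... | p-prime , _   | inj₁ refl = ¬prime[1] p-prime
  ... | _       , p∣n | inj₂ refl = n-odd p∣n

  reduce : ℤ → Fin n
  reduce z = fromℕ< (n%ℕd<d z n)

  reduce-≡mod : ∀ z → p ∣ n → + toℕ (reduce z) ≡ z mod p
  reduce-≡mod z p∣n = subst (λ m → + m ≡ z mod _) (sym (Finₚ.toℕ-fromℕ< _)) (%ℕ-≡mod z p∣n)

  isUnit-by-primes : ∀ a → (∀ {p} → p ∈ ps → ¬ + p ∣ᶻ + toℕ a) → IsUnit n a
  isUnit-by-primes a p∤a = coprime-by-primes (≢-nonZero⁻¹ n)
    (λ p p-prime p∣n p∣a → p∤a (∈-primeDivisors⁺ p-prime p∣n) (ℤ∣.∣ᵤ⇒∣ p∣a))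

  1∈S : InS n (reduce 1ℤ)
  1∈S = isUnit-by-primes (reduce 1ℤ) p∤1 , jacobi≡1
    where
    p∤1 : p ∈ ps → ¬ + p ∣ᶻ + toℕ (reduce 1ℤ)
    p∤1 {p} p∈ps p∣a = let (p-prime , p∣n) = ∈-primeDivisors⁻ {n = n} p∈ps in
      prime∤1ᶻ p-prime (≡mod-∣ (≡mod-sym (reduce-≡mod 1ℤ p∣n)) p∣a)
    jacobi≡1 : jacobi n (toℕ (reduce 1ℤ)) ≡ 1ℤ
    jacobi≡1 = trans (jacobi-squarefree sqf _) (∏≡1 ps λ {p} p∈ps →
      let (p-prime , p∣n) = ∈-primeDivisors⁻ {n = n} p∈ps in
      trans (legendre-≡mod (reduce-≡mod 1ℤ p∣n)) (legendre-1 p-prime))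

  private
    module Correction (r : ℕ → ℤ) (r-unit : ∀ {p} → p ∈ ps → ¬ + p ∣ᶻ r p) {q} (q∈ps : q ∈ ps) where

      σ : ℤ
      σ = ∏ (others q ps) (λ p → legendre p (r p %ℕ n))

      patched : ℕ → ℕ → ℤ
      patched t p = if does (p ℕₚ.≟ q) then + t else r p

      patched-≡ : ∀ t → patched t q ≡ + t
      patched-≡ t rewrite dec-true (q ℕₚ.≟ q) refl = refl

      patched-≢ : ∀ t → p ≢ q → patched t p ≡ r p
      patched-≢ {p} t p≢q rewrite dec-false (p ℕₚ.≟ q) p≢q = refl

      lift-patched : ∀ t → ¬ + q ∣ᶻ + t →
        ∃[ a ] IsUnit n a × (∀ {p} → p ∈ ps → p ≢ q → + toℕ a ≡ r p mod p)
               × jacobi n (toℕ a) ≡ legendre q t * σ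
      lift-patched t q∤t = lifted , isUnit-by-primes lifted lifted-unit , agrees , jacobi≡
        where
        solution : ℤ
        solution = proj₁ (chineseRemainder (primeDivisors-unique n) (primeDivisors-prime n) (patched t))
        lifted : Fin n
        lifted = reduce solution
        lifted≡patched : p ∈ ps → + toℕ lifted ≡ patched t p mod p
        lifted≡patched p∈ps = ≡mod-trans (reduce-≡mod solution (proj₂ (∈-primeDivisors⁻ {n = n} p∈ps)))
          (proj₂ (chineseRemainder (primeDivisors-unique n) (primeDivisors-prime n) (patched t)) p∈ps)
        agrees : p ∈ ps → p ≢ q → + toℕ lifted ≡ r p mod p
        agrees {p} p∈ps p≢q =
          subst (λ s → + toℕ lifted ≡ s mod p) (patched-≢ t p≢q) (lifted≡patched p∈ps)
        lifted≡t : + toℕ lifted ≡ + t mod q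
        lifted≡t = subst (λ s → + toℕ lifted ≡ s mod q) (patched-≡ t) (lifted≡patched q∈ps)
        lifted-unit : p ∈ ps → ¬ + p ∣ᶻ + toℕ lifted
        lifted-unit {p} p∈ps with p ℕₚ.≟ q
        ... | yes refl = ∤-≡mod (lifted≡t) q∤t
        ... | no p≢q = ∤-≡mod (agrees p∈ps p≢q) (r-unit p∈ps)
        jacobi≡ : jacobi n (toℕ lifted) ≡ legendre q t * σ
        jacobi≡ = begin
          jacobi n (toℕ lifted)
            ≡⟨ jacobi-squarefree sqf (toℕ lifted) ⟩
          ∏ ps (λ p → legendre p (toℕ lifted))
            ≡⟨ ∏-split (λ p → legendre p (toℕ lifted)) (primeDivisors-unique n) q∈ps ⟩
          legendre q (toℕ lifted) * ∏ (others q ps) (λ p → legendre p (toℕ lifted))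
            ≡⟨ cong₂ _*_ (legendre-≡mod lifted≡t) (∏-cong (others q ps) others-agree) ⟩
          legendre q t * σ ∎
          where
          open ≡-Reasoning
          others-agree : p ∈ others q ps → legendre p (toℕ lifted) ≡ legendre p (r p %ℕ n)
          others-agree p∈others =
            let (p∈ps , p≢q) = ∈-filter⁻ (λ p → ¬? (p ℕₚ.≟ q)) {xs = ps} p∈others in
            legendre-≡mod (≡mod-trans (agrees p∈ps p≢q)
                                      (≡mod-sym (%ℕ-≡mod (r _) (proj₂ (∈-primeDivisors⁻ {n = n} p∈ps)))))

  -- Only the residue at q is free; the Legendre symbols at the other primes multiply
  -- to σ = ±1, and the residue 1 or a non-residue at q cancels it.
  ∈S-agreeing-off : q ∈ ps → (r : ℕ → ℤ) → (∀ {p} → p ∈ ps → ¬ + p ∣ᶻ r p) →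
    ∃[ a ] InS n a × (∀ {p} → p ∈ ps → p ≢ q → + toℕ a ≡ r p mod p)
  ∈S-agreeing-off {q} q∈ps r r-unit = choose (∏≡±1 (others q ps) (λ p → legendre≡±1 p (r p %ℕ n)))
    where
    open Correction r r-unit q∈ps
    q-prime : Prime q
    q-prime = proj₁ (∈-primeDivisors⁻ {n = n} q∈ps)
    Goal : Set
    Goal = ∃[ a ] InS n a × (∀ {p} → p ∈ ps → p ≢ q → + toℕ a ≡ r p mod p)
    lift-to-S : ∀ {t} → ¬ + q ∣ᶻ + t → legendre q t * σ ≡ 1ℤ → Goal
    lift-to-S q∤t legendre*σ≡1 =
      let (a , a-unit , agrees , jacobi≡) = lift-patched _ q∤t
      in a , (a-unit , trans jacobi≡ legendre*σ≡1) , agrees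
    -1*-1≡1 : -1ℤ * -1ℤ ≡ 1ℤ
    -1*-1≡1 = refl
    choose : σ ≡ 1ℤ ⊎ σ ≡ -1ℤ → Goal
    choose (inj₁ σ≡1) = lift-to-S (prime∤1ᶻ q-prime) (cong₂ _*_ (legendre-1 q-prime) σ≡1)
    choose (inj₂ σ≡-1) with nonresidue q-prime (∈ps⇒odd q∈ps)
    ... | c , q∤c , no-root =
      lift-to-S q∤c (trans (cong₂ _*_ (legendre-nonresidue no-root) σ≡-1) -1*-1≡1)

  -- A term divisible by some prime q ∣ n does not see the residue of its weight at q;
  -- a term without such a divisor is a unit, and then every residue r p is 1.
  weight-for-term : (r : ℕ → ℤ) → (∀ {p} → p ∈ ps → ¬ + p ∣ᶻ r p) → ∀ x →
    (Coprime x n → ∀ {p} → p ∈ ps → r p ≡ 1ℤ mod p) →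
    ∃[ a ] InS n a × (∀ {p} → p ∈ ps → + toℕ a * + x ≡ r p * + x mod p)
  weight-for-term r r-unit x unit⇒r≡1 with Any.any? (λ q → q ∣? x) ps
  ... | yes divisor = weight-from-divisor (proj₁ (proj₂ (find divisor))) (proj₂ (proj₂ (find divisor)))
    where
    weight-from-divisor : q ∈ ps → q ∣ x →
      ∃[ a ] InS n a × (∀ {p} → p ∈ ps → + toℕ a * + x ≡ r p * + x mod p)
    weight-from-divisor {q} q∈ps q∣x = extend (∈S-agreeing-off q∈ps r r-unit)
      where
      extend : ∃[ a ] InS n a × (∀ {p} → p ∈ ps → p ≢ q → + toℕ a ≡ r p mod p) →
               ∃[ a ] InS n a × (∀ {p} → p ∈ ps → + toℕ a * + x ≡ r p * + x mod p)
      extend (a , a∈S , agrees) = a , a∈S , same-term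
        where
        same-term : p ∈ ps → + toℕ a * + x ≡ r p * + x mod p
        same-term {p} p∈ps with p ℕₚ.≟ q
        ... | yes refl = ≡mod-trans (∣⇒≡mod-0 (ℤ∣.∣n⇒∣m*n (+ toℕ a) (ℤ∣.∣ᵤ⇒∣ q∣x)))
                                    (≡mod-sym (∣⇒≡mod-0 (ℤ∣.∣n⇒∣m*n (r p) (ℤ∣.∣ᵤ⇒∣ q∣x))))
        ... | no p≢q = ≡mod-* (agrees p∈ps p≢q) ≡mod-refl
  ... | no no-divisor = reduce 1ℤ , 1∈S , same-term
    where
    x-unit : Coprime x n
    x-unit = coprime-by-primes (≢-nonZero⁻¹ n)
      (λ p p-prime p∣n p∣x → no-divisor (lose (∈-primeDivisors⁺ p-prime p∣n) p∣x))
    same-term : p ∈ ps → + toℕ (reduce 1ℤ) * + x ≡ r p * + x mod p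
    same-term p∈ps = ≡mod-* (≡mod-trans (reduce-≡mod 1ℤ (proj₂ (∈-primeDivisors⁻ {n = n} p∈ps)))
                                       (≡mod-sym (unit⇒r≡1 x-unit p∈ps)))
                            ≡mod-refl

module Weights (n : ℕ) {{_ : NonZero n}} (n-odd : Odd n) (sqf : Squarefree n)
  (l : ℕ) (x : Fin l → Fin n)
  (two-coprime : ∀ p → Prime p → p ∣ n →
    Σ (Fin l) λ i → Σ (Fin l) λ j → i ≢ j × Coprime (toℕ (x i)) p × Coprime (toℕ (x j)) p)
  (unit-unique : ∀ i j → IsUnit n (x i) → IsUnit n (x j) → i ≡ j) where

  open SquarefreeOdd n sqf n-odd

  xᶻ : Vector ℤ l
  xᶻ k = + toℕ (x k)

  WeightsMod : ℕ → Vector ℤ l → Set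
  WeightsMod p w = UnitWeightedZeroSum p xᶻ w × (∀ k → IsUnit n (x k) → w k ≡ 1ℤ mod p)

  ∃-weightsMod : ∀ {p} → Prime p → p ∣ n → ∃[ w ] WeightsMod p w
  ∃-weightsMod {p} p-prime p∣n =
    let (i , j , i≢j , xᵢ-coprime , xⱼ-coprime) = two-coprime p p-prime p∣n in
    unitWeightedZeroSum-with-1-at p-prime (∈ps⇒odd (∈-primeDivisors⁺ p-prime p∣n)) xᶻ i≢j
      (coprime⇒∤ᶻ p-prime xᵢ-coprime) (coprime⇒∤ᶻ p-prime xⱼ-coprime)
      (λ k → coprime? (toℕ (x k)) n) unit-unique

  -- Total in p so that it can be handed to the Chinese remainder theorem.
  weightsMod : ℕ → Vector ℤ l
  weightsMod p with prime? p ×-dec p ∣? n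
  ... | yes (p-prime , p∣n) = proj₁ (∃-weightsMod p-prime p∣n)
  ... | no _                = λ _ → 1ℤ

  weightsMod-ok : ∀ {p} → p ∈ ps → WeightsMod p (weightsMod p)
  weightsMod-ok {p} p∈ps with prime? p ×-dec p ∣? n
  ... | yes (p-prime , p∣n) = proj₂ (∃-weightsMod p-prime p∣n)
  ... | no ¬p               = contradiction (∈-primeDivisors⁻ {n = n} p∈ps) ¬p

  term-weight : ∀ k → ∃[ a ] InS n a × (∀ {p} → p ∈ ps → + toℕ a * xᶻ k ≡ weightsMod p k * xᶻ k mod p)
  term-weight k = weight-for-term (λ p → weightsMod p k) (λ p∈ps → proj₁ (proj₁ (weightsMod-ok p∈ps)) k)
                                  (toℕ (x k)) (λ x-unit p∈ps → proj₂ (weightsMod-ok p∈ps) k x-unit)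

  weight : Fin l → Fin n
  weight k = proj₁ (term-weight k)

  weight∈S : ∀ k → InS n (weight k)
  weight∈S k = proj₁ (proj₂ (term-weight k))

  n∣weighted-sum : n ∣ sumFin l (λ k → toℕ (weight k) ℕ.* toℕ (x k))
  n∣weighted-sum = squarefree⇒∣ sqf λ p p-prime p∣n →
    let p∈ps = ∈-primeDivisors⁺ p-prime p∣n in
    ℤ∣.∣⇒∣ᵤ (≡mod-∣ (≡mod-trans (≡mod-reflexive as-integer-sum)
                     (≡mod-trans (sum-≡mod (λ k → proj₂ (proj₂ (term-weight k)) p∈ps))
                                 (proj₂ (proj₁ (weightsMod-ok p∈ps)))))
                    (ℤ∣.∣ᵤ⇒∣ (p ∣0)))
    where
    as-integer-sum :
      + sumFin l (λ k → toℕ (weight k) ℕ.* toℕ (x k)) ≡ sum (λ k → + toℕ (weight k) * xᶻ k)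
    as-integer-sum = trans (+-sumFin l _) (sum-cong-≗ (λ k → ℤₚ.pos-* (toℕ (weight k)) (toℕ (x k))))

lemma2p10 : (n : ℕ) → Odd n → Squarefree n →
    (l : ℕ) → (x : Fin l → Fin n) →
    (∀ p → Prime p → p ∣ n →
      Σ (Fin l) λ i → Σ (Fin l) λ j → i ≢ j × Coprime (toℕ (x i)) p × Coprime (toℕ (x j)) p) →
    (∀ i j → IsUnit n (x i) → IsUnit n (x j) → i ≡ j) →
    WeightedZeroSum n (InS n) l x
lemma2p10 zero      n-odd = ⊥-elim (n-odd (2 ∣0))
lemma2p10 n@(suc _) n-odd sqf l x two-coprime unit-unique =
  weight , weight∈S , n∣weighted-sum
  where open Weights n n-odd sqf l x two-coprime unit-unique
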